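{- If $\mathcal{B}$ is a bramble of order $k$ in a digraph $G$, then $G$ contains a tangle of order $\lfloor k/3\rfloor$.
   Context: A bramble in $G$ is a set $\mathcal{B}$ of strongly connected subgraphs of $G$ such that every two members share a vertex; its order is the minimum size of a set of vertices meeting every member. A directed separation of $G$ is a pair $(A,B)$ of subgraphs with $V(A)\cup V(B)=V(G)$ such that either no edge has tail in $V(A)\setminus V(B)$ and head in $V(B)\setminus V(A)$, or no edge has tail in $V(B)\setminus V(A)$ and head in $V(A)\setminus V(B)$; its order is $|V(A)\cap V(B)|$. A tangle of order $k$ in $G$ is a set $\mathcal{T}$ of directed separations of order $<k$ such that (i) for every directed separation $(A,B)$ of order $<k$, $(A,B)\in\mathcal{T}$ or $(B,A)\in\mathcal{T}$, and (ii) for all (not necessarily distinct) $(A_1,B_1),(A_2,B_2),(A_3,B_3)\in\mathcal{T}$, $V(A_1)\cup V(A_2)\cup V(A_3)\neq V(G)$. -}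

module Defs where

open import Data.Nat using (ℕ; _<_; _≥_)
open import Data.Bool using (Bool; true)
open import Data.Fin using (Fin)
open import Data.Fin.Subset using (Subset; _∈_; _∉_; _∩_; ∣_∣)
open import Data.List using (List)
open import Data.List.Membership.Propositional using () renaming (_∈_ to _∈ˡ_)
open import Data.Empty using (⊥)
open import Data.Product using (Σ; ∃; _×_)
open import Data.Sum using (_⊎_)
open import Relation.Nullary using (¬_)
open import Relation.Binary.PropositionalEquality using (_≡_)

-- Parallel edges are irrelevant for all notions involved, so a Bool-valued
-- adjacency relation suffices (loops are allowed).
record Digraph : Set where
  field
    n : ℕ
    E : Fin n → Fin n → Bool
open Digraph public

Vtx : Digraph → Set
Vtx G = Fin (n G)

record Subgraph (G : Digraph) : Set where
  field
    V     : Subset (n G)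
    ES    : Vtx G → Vtx G → Bool
    ES⊆E  : ∀ u v → ES u v ≡ true → E G u v ≡ true
    ES-ends : ∀ u v → ES u v ≡ true → (u ∈ V) × (v ∈ V)
open Subgraph public

data Reach {G : Digraph} (H : Subgraph G) : Vtx G → Vtx G → Set where
  here : ∀ {u} → Reach H u u
  step : ∀ {u v w} → ES H u v ≡ true → Reach H v w → Reach H u w

StronglyConnected : {G : Digraph} → Subgraph G → Set
StronglyConnected {G} H =
  (∃ λ (v : Vtx G) → v ∈ V H) ×
  (∀ u v → u ∈ V H → v ∈ V H → Reach H u v)

IsBramble : (G : Digraph) → List (Subgraph G) → Set
IsBramble G ℬ =
  (∀ {H} → H ∈ˡ ℬ → StronglyConnected H) ×
  (∀ {H₁ H₂} → H₁ ∈ˡ ℬ → H₂ ∈ˡ ℬ → ∃ λ v → v ∈ V H₁ × v ∈ V H₂)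

Hits : {G : Digraph} → Subset (n G) → List (Subgraph G) → Set
Hits X ℬ = ∀ {H} → H ∈ˡ ℬ → ∃ λ v → v ∈ X × v ∈ V H

BrambleOrder : (G : Digraph) → List (Subgraph G) → ℕ → Set
BrambleOrder G ℬ k =
  (Σ (Subset (n G)) λ X → Hits X ℬ × ∣ X ∣ ≡ k) ×
  (∀ (X : Subset (n G)) → Hits X ℬ → ∣ X ∣ ≥ k)

IsDirSep : (G : Digraph) → Subgraph G → Subgraph G → Set
IsDirSep G A B =
  (∀ v → v ∈ V A ⊎ v ∈ V B) ×
  ( (∀ u v → E G u v ≡ true → u ∈ V A → u ∉ V B → v ∈ V B → v ∉ V A → ⊥)
  ⊎ (∀ u v → E G u v ≡ true → u ∈ V B → u ∉ V A → v ∈ V A → v ∉ V B → ⊥))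

sepOrder : {G : Digraph} → Subgraph G → Subgraph G → ℕ
sepOrder A B = ∣ V A ∩ V B ∣

IsTangle : (G : Digraph) → (Subgraph G → Subgraph G → Set) → ℕ → Set
IsTangle G 𝒯 k =
  (∀ A B → 𝒯 A B → IsDirSep G A B × sepOrder A B < k) ×
  (∀ A B → IsDirSep G A B → sepOrder A B < k → 𝒯 A B ⊎ 𝒯 B A) ×
  (∀ A₁ B₁ A₂ B₂ A₃ B₃ → 𝒯 A₁ B₁ → 𝒯 A₂ B₂ → 𝒯 A₃ B₃ →
     ¬ (∀ v → v ∈ V A₁ ⊎ v ∈ V A₂ ⊎ v ∈ V A₃))

HasTangle : (G : Digraph) → ℕ → Set₁
HasTangle G k = ∃ λ (𝒯 : Subgraph G → Subgraph G → Set) → IsTangle G 𝒯 k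

-- Orient a separation (A , B) of order < k/3 towards B when some member of
-- the bramble avoids V A.  A strongly connected subgraph that misses the
-- separator cannot have vertices on both sides: a path there and a path back
-- would use an edge from A ∖ B to B ∖ A and one from B ∖ A to A ∖ B.  Since
-- fewer than k vertices do not hit the bramble, every separation is oriented,
-- and three sides A₁, A₂, A₃ cannot cover G: a member avoiding all three
-- separators meets each of the three witnessing members, hence lies outside
-- every Aᵢ.
module Submission where

open import Defs
open import Data.Nat using (ℕ; _/_; _+_; _*_; _<_; _≤_; _≥_; s≤s; z≤n)
open import Data.Nat.Properties
  using (≤-trans; <-≤-trans; <⇒≱; ≤-reflexive; m≤m+n; n≤1+n; +-suc; +-monoʳ-≤; +-mono-<; *-comm)
open import Data.Nat.DivMod using (m/n*n≤m)
open import Data.Bool using (true; false)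
open import Data.Vec using ([]; _∷_)
open import Data.List using (List)
open import Data.List.Membership.Propositional using (find) renaming (_∈_ to _∈ˡ_)
open import Data.List.Relation.Unary.All using (lookup)
open import Data.List.Relation.Unary.All.Properties using (¬All⇒Any¬)
open import Data.Fin.Subset using (Subset; _∈_; _∉_; _⊆_; _∩_; _∪_; ∁; ∣_∣)
open import Data.Fin.Subset.Properties
  using (_∈?_; x∈p∩q⁺; x∈p∩q⁻; p⊆p∪q; q⊆p∪q; ∩-comm; x∈p⇒x∉∁p; x∈∁p⇒x∉p; x∉p⇒x∈∁p; x∉∁p⇒x∈p)
open import Data.Fin.Properties using (any?)
open import Data.Empty using (⊥; ⊥-elim)
open import Data.Product using (∃; ∃₂; _×_; _,_; proj₁; proj₂; swap)
open import Data.Sum using (_⊎_; inj₁; inj₂) renaming (swap to swap-⊎)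
open import Function using (_∘_)
open import Relation.Nullary using (¬_; yes; no)
open import Relation.Nullary.Decidable using (_×-dec_)
open import Relation.Binary.PropositionalEquality using (_≡_; sym; subst)

∣p∪q∣≤∣p∣+∣q∣ : ∀ {m} (p q : Subset m) → ∣ p ∪ q ∣ ≤ ∣ p ∣ + ∣ q ∣
∣p∪q∣≤∣p∣+∣q∣ []          []          = z≤n
∣p∪q∣≤∣p∣+∣q∣ (true ∷ p)  (true ∷ q)  = s≤s (≤-trans (∣p∪q∣≤∣p∣+∣q∣ p q) (+-monoʳ-≤ ∣ p ∣ (n≤1+n ∣ q ∣)))
∣p∪q∣≤∣p∣+∣q∣ (true ∷ p)  (false ∷ q) = s≤s (∣p∪q∣≤∣p∣+∣q∣ p q)
∣p∪q∣≤∣p∣+∣q∣ (false ∷ p) (true ∷ q)  = ≤-trans (s≤s (∣p∪q∣≤∣p∣+∣q∣ p q)) (≤-reflexive (sym (+-suc ∣ p ∣ ∣ q ∣)))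
∣p∪q∣≤∣p∣+∣q∣ (false ∷ p) (false ∷ q) = ∣p∪q∣≤∣p∣+∣q∣ p q

+-<-three : ∀ {a b c m} → a < m → b < m → c < m → a + (b + c) < 3 * m
+-<-three {m = m} a<m b<m c<m = +-mono-< a<m (+-mono-< b<m (<-≤-trans c<m (m≤m+n m 0)))

3*[n/3]≤n : ∀ n → 3 * (n / 3) ≤ n
3*[n/3]≤n n = ≤-trans (≤-reflexive (*-comm 3 (n / 3))) (m/n*n≤m n 3)

Avoids : {G : Digraph} → Subgraph G → Subset (n G) → Set
Avoids H X = ∀ {v} → v ∈ V H → v ∉ X

Avoids-⊆ : {G : Digraph} (H : Subgraph G) {X Y : Subset (n G)} → X ⊆ Y → Avoids H Y → Avoids H X
Avoids-⊆ H X⊆Y H∌Y vH = H∌Y vH ∘ X⊆Y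

Avoids-∩-comm : {G : Digraph} (H : Subgraph G) {X Y : Subset (n G)} → Avoids H (X ∩ Y) → Avoids H (Y ∩ X)
Avoids-∩-comm H = Avoids-⊆ H (x∈p∩q⁺ ∘ swap ∘ x∈p∩q⁻ _ _)

reach-exits : {G : Digraph} (H : Subgraph G) (S : Subset (n G)) {x y : Vtx G} →
  Reach H x y → x ∈ S → y ∉ S → ∃₂ λ u v → ES H u v ≡ true × u ∈ S × v ∉ S
reach-exits H S here x∈S y∉S = ⊥-elim (y∉S x∈S)
reach-exits H S (step {v = v} e r) x∈S y∉S with v ∈? S
... | yes v∈S = reach-exits H S r v∈S y∉S
... | no  v∉S = _ , v , e , x∈S , v∉S

IsDirSep-swap : ∀ {G} (A B : Subgraph G) → IsDirSep G A B → IsDirSep G B A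
IsDirSep-swap A B (cover , oneWay) = swap-⊎ ∘ cover , swap-⊎ oneWay

IsDirSep-oneWay : ∀ {G} (A B : Subgraph G) → IsDirSep G A B → ∀ {u u′ t t′} →
  E G u u′ ≡ true → u ∈ V A → u ∉ V B → u′ ∈ V B → u′ ∉ V A →
  E G t t′ ≡ true → t ∈ V B → t ∉ V A → t′ ∈ V A → t′ ∉ V B → ⊥
IsDirSep-oneWay A B (_ , inj₁ noAB) e uA uB u′B u′A _ _ _ _ _ = noAB _ _ e uA uB u′B u′A
IsDirSep-oneWay A B (_ , inj₂ noBA) _ _ _ _ _ e tB tA t′A t′B = noBA _ _ e tB tA t′A t′B

strongly-connected-outside : ∀ {G} (A B H : Subgraph G) → IsDirSep G A B → StronglyConnected H →
  Avoids H (V A ∩ V B) → ∀ {w} → w ∈ V H → w ∉ V A → Avoids H (V A)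
strongly-connected-outside A B H sep@(cover , _) (_ , reach) H∌AB {w} wH w∉A {v} vH v∈A
  with reach-exits H (V A) (reach v w vH wH) v∈A w∉A
     | reach-exits H (∁ (V A)) (reach w v wH vH) (x∉p⇒x∈∁p w∉A) (x∈p⇒x∉∁p v∈A)
... | u , u′ , e , u∈A , u′∉A | t , t′ , f , t∈∁A , t′∉∁A =
  IsDirSep-oneWay A B sep
    (ES⊆E H u u′ e) u∈A (∈A⇒∉B (proj₁ (ES-ends H u u′ e)) u∈A) (∉A⇒∈B u′∉A) u′∉A
    (ES⊆E H t t′ f) (∉A⇒∈B t∉A) t∉A t′∈A (∈A⇒∉B (proj₂ (ES-ends H t t′ f)) t′∈A)
  where
  t∉A  = x∈∁p⇒x∉p t∈∁A
  t′∈A = x∉∁p⇒x∈p t′∉∁A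
  ∈A⇒∉B : ∀ {x} → x ∈ V H → x ∈ V A → x ∉ V B
  ∈A⇒∉B xH xA xB = H∌AB xH (x∈p∩q⁺ (xA , xB))
  ∉A⇒∈B : ∀ {x} → x ∉ V A → x ∈ V B
  ∉A⇒∈B {x} x∉A with cover x
  ... | inj₁ x∈A = ⊥-elim (x∉A x∈A)
  ... | inj₂ x∈B = x∈B

strongly-connected-one-side : ∀ {G} (A B H : Subgraph G) → IsDirSep G A B → StronglyConnected H →
  Avoids H (V A ∩ V B) → Avoids H (V A) ⊎ Avoids H (V B)
strongly-connected-one-side A B H sep sc@((w , wH) , _) H∌AB with w ∈? V A
... | no  w∉A = inj₁ (strongly-connected-outside A B H sep sc H∌AB wH w∉A)
... | yes w∈A = inj₂ (strongly-connected-outside B A H (IsDirSep-swap A B sep) sc (Avoids-∩-comm H H∌AB) wH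
                        (H∌AB wH ∘ x∈p∩q⁺ ∘ (w∈A ,_)))

avoiding-member : ∀ {G} {X : Subset (n G)} (ℬ : List (Subgraph G)) →
  ¬ Hits X ℬ → ∃ λ H → H ∈ˡ ℬ × Avoids H X
avoiding-member {X = X} ℬ ¬hits
  with find (¬All⇒Any¬ meets? ℬ (¬hits ∘ lookup))
  where meets? = λ H → any? λ v → (v ∈? X) ×-dec (v ∈? V H)
... | H , H∈ℬ , ¬meets = H , H∈ℬ , λ vH vX → ¬meets (_ , vX , vH)

brambleTangle : {G : Digraph} → List (Subgraph G) → ℕ → Subgraph G → Subgraph G → Set
brambleTangle {G} ℬ m A B =
  (IsDirSep G A B × sepOrder A B < m) × ∃ λ H → H ∈ˡ ℬ × Avoids H (V A)

module _ {G : Digraph} {ℬ : List (Subgraph G)} {k m : ℕ}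
         (bramble : IsBramble G ℬ) (hits⇒≥k : ∀ X → Hits X ℬ → ∣ X ∣ ≥ k) (3m≤k : 3 * m ≤ k) where

  private
    small-avoided : {X : Subset (n G)} → ∣ X ∣ < k → ∃ λ H → H ∈ˡ ℬ × Avoids H X
    small-avoided {X} ∣X∣<k = avoiding-member ℬ λ hits → <⇒≱ ∣X∣<k (hits⇒≥k X hits)

    avoids-side-of-member : ∀ A B {H Hₐ} → IsDirSep G A B → H ∈ˡ ℬ → Avoids H (V A ∩ V B) →
      Hₐ ∈ˡ ℬ → Avoids Hₐ (V A) → Avoids H (V A)
    avoids-side-of-member A B {H} sep H∈ℬ H∌AB Hₐ∈ℬ Hₐ∌A with proj₂ bramble H∈ℬ Hₐ∈ℬ
    ... | w , wH , wHₐ = strongly-connected-outside A B H sep (proj₁ bramble H∈ℬ) H∌AB wH (Hₐ∌A wHₐ)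

    union-of-three-small : (S₁ S₂ S₃ : Subset (n G)) → ∣ S₁ ∣ < m → ∣ S₂ ∣ < m → ∣ S₃ ∣ < m →
      ∣ S₁ ∪ (S₂ ∪ S₃) ∣ < k
    union-of-three-small S₁ S₂ S₃ ∣S₁∣<m ∣S₂∣<m ∣S₃∣<m =
      <-≤-trans (s≤s (≤-trans (∣p∪q∣≤∣p∣+∣q∣ S₁ (S₂ ∪ S₃)) (+-monoʳ-≤ ∣ S₁ ∣ (∣p∪q∣≤∣p∣+∣q∣ S₂ S₃))))
                (≤-trans (+-<-three ∣S₁∣<m ∣S₂∣<m ∣S₃∣<m) 3m≤k)

  brambleTangle-orients : ∀ A B → IsDirSep G A B → sepOrder A B < m →
    brambleTangle ℬ m A B ⊎ brambleTangle ℬ m B A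
  brambleTangle-orients A B sep ord
    with small-avoided (<-≤-trans ord (≤-trans (m≤m+n m _) 3m≤k))
  ... | H , H∈ℬ , H∌AB with strongly-connected-one-side A B H sep (proj₁ bramble H∈ℬ) H∌AB
  ... | inj₁ H∌A = inj₁ ((sep , ord) , H , H∈ℬ , H∌A)
  ... | inj₂ H∌B = inj₂ ((IsDirSep-swap A B sep , subst (λ S → ∣ S ∣ < m) (∩-comm (V A) (V B)) ord) , H , H∈ℬ , H∌B)

  brambleTangle-noThreeCover : ∀ A₁ B₁ A₂ B₂ A₃ B₃ →
    brambleTangle ℬ m A₁ B₁ → brambleTangle ℬ m A₂ B₂ → brambleTangle ℬ m A₃ B₃ →
    ¬ (∀ v → v ∈ V A₁ ⊎ v ∈ V A₂ ⊎ v ∈ V A₃)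
  brambleTangle-noThreeCover A₁ B₁ A₂ B₂ A₃ B₃
    ((sep₁ , ord₁) , H₁ , H₁∈ℬ , H₁∌A₁) ((sep₂ , ord₂) , H₂ , H₂∈ℬ , H₂∌A₂) ((sep₃ , ord₃) , H₃ , H₃∈ℬ , H₃∌A₃) cover
    with small-avoided (union-of-three-small (V A₁ ∩ V B₁) (V A₂ ∩ V B₂) (V A₃ ∩ V B₃) ord₁ ord₂ ord₃)
  ... | H , H∈ℬ , H∌S with proj₁ (proj₁ bramble H∈ℬ)
  ... | v , vH with cover v
  ... | inj₁ v∈A₁ = avoids-side-of-member A₁ B₁ sep₁ H∈ℬ (Avoids-⊆ H (p⊆p∪q _) H∌S) H₁∈ℬ H₁∌A₁ vH v∈A₁
  ... | inj₂ (inj₁ v∈A₂) = avoids-side-of-member A₂ B₂ sep₂ H∈ℬ (Avoids-⊆ H (q⊆p∪q _ _ ∘ p⊆p∪q _) H∌S) H₂∈ℬ H₂∌A₂ vH v∈A₂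
  ... | inj₂ (inj₂ v∈A₃) = avoids-side-of-member A₃ B₃ sep₃ H∈ℬ (Avoids-⊆ H (q⊆p∪q _ _ ∘ q⊆p∪q _ _) H∌S) H₃∈ℬ H₃∌A₃ vH v∈A₃

  brambleTangle-isTangle : IsTangle G (brambleTangle ℬ m) m
  brambleTangle-isTangle = (λ _ _ → proj₁) , brambleTangle-orients , brambleTangle-noThreeCover

lemma5p8 : (G : Digraph) (ℬ : List (Subgraph G)) (k : ℕ) →
    IsBramble G ℬ → BrambleOrder G ℬ k → HasTangle G (k / 3)
lemma5p8 G ℬ k bramble (_ , hits⇒≥k) =
  brambleTangle ℬ (k / 3) , brambleTangle-isTangle bramble hits⇒≥k (3*[n/3]≤n k)
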